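{- Let $\omega=\frac{ -1+\sqrt{ -3}}{2}$ and let $\frac{r}{s}$ be an irreducible fraction. (1) If $s$ is a multiple of $3$, then $\mathcal{S}_{\frac{r}{s}}(q)$ is divisible by $[3]_q=1+q+q^2$ in $\mathbb Z[q]$. Moreover $\mathcal{S}_{\frac{r}{s}}(\omega)=0$ if $s\equiv0\pmod 3$, $\mathcal{S}_{\frac{r}{s}}(\omega)\in\{1,\omega,\omega^2\}$ if $s\equiv1\pmod3$, and $\mathcal{S}_{\frac{r}{s}}(\omega)\in\{ -1,-\omega,-\omega^2\}$ if $s\equiv2\pmod3$. (2) Similarly, $\mathcal{R}_{\frac{r}{s}}(\omega)=0$ if $r\equiv0\pmod 3$, $\mathcal{R}_{\frac{r}{s}}(\omega)\in\{1,\omega,\omega^2\}$ if $r\equiv1\pmod3$, and $\mathcal{R}_{\frac{r}{s}}(\omega)\in\{ -1,-\omega,-\omega^2\}$ if $r\equiv2\pmod3$.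
   Context: For an integer $c$, $[c]_q=\frac{1-q^c}{1-q}$. Every rational $\alpha>1$ has a unique negative continued fraction expansion $\alpha=c_1-\cfrac{1}{c_2-\cfrac{1}{\ddots-\cfrac{1}{c_l}}}$ with integers $c_j\ge 2$. Put $M^-_q(c)=\begin{pmatrix}[c]_q & -q^{c-1}\\ 1 & 0\end{pmatrix}$ and define $\mathcal{R}_\alpha(q),\mathcal{S}_\alpha(q)$ by $\begin{pmatrix}\mathcal{R}_\alpha(q)\\ \mathcal{S}_\alpha(q)\end{pmatrix}=M^-_q(c_1)\cdots M^-_q(c_l)\begin{pmatrix}1\\0\end{pmatrix}$. For rational $\alpha\le 1$ they are defined recursively by $\mathcal{S}_\alpha(q)=\mathcal{S}_{\alpha+1}(q)$ and $\mathcal{R}_\alpha(q)=q^{ -1}(\mathcal{R}_{\alpha+1}(q)-\mathcal{S}_{\alpha+1}(q))$. Here $\mathcal{S}_\alpha(q)\in\mathbb Z[q]$ and $\mathcal{R}_\alpha(q)\in\mathbb Z[q,q^{ -1}]$; for an irreducible fraction $\frac{r}{s}$ (i.e. $\gcd(r,s)=1$, $s>0$) one has $\mathcal{R}_{\frac rs}(1)=r$, $\mathcal{S}_{\frac rs}(1)=s$. -}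

module Defs where

open import Data.Nat as ℕ using (ℕ; zero; suc; _∸_; _/_)
open import Data.Integer as ℤ using (ℤ; +_; -_; _-_)
open import Data.List using (List; []; _∷_; replicate; foldr)
open import Data.Product using (_×_; _,_; proj₁; proj₂; Σ)
open import Data.Sum using (_⊎_)
open import Relation.Binary.PropositionalEquality using (_≡_)
open import Relation.Nullary using (yes; no)

-- Polynomials in ℤ[q]: coefficient lists, lowest degree first.

Poly : Set
Poly = List ℤ

coeff : Poly → ℕ → ℤ
coeff []       _       = + 0
coeff (a ∷ p)  zero    = a
coeff (a ∷ p)  (suc n) = coeff p n

-- equality of polynomials (coefficientwise; trailing zeros irrelevant)
_≈P_ : Poly → Poly → Set
p ≈P p' = ∀ n → coeff p n ≡ coeff p' n

infixl 6 _+P_ _-P_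
infixl 7 _*P_ _·P_

_+P_ : Poly → Poly → Poly
[]      +P p'       = p'
p       +P []       = p
(a ∷ p) +P (b ∷ p') = (a ℤ.+ b) ∷ (p +P p')

negP : Poly → Poly
negP []      = []
negP (a ∷ p) = (- a) ∷ negP p

_-P_ : Poly → Poly → Poly
p -P p' = p +P negP p'

_·P_ : ℤ → Poly → Poly
a ·P []       = []
a ·P (b ∷ p)  = (a ℤ.* b) ∷ (a ·P p)

shiftP : Poly → Poly
shiftP p = + 0 ∷ p

_*P_ : Poly → Poly → Poly
[]      *P p' = []
(a ∷ p) *P p' = (a ·P p') +P shiftP (p *P p')

qPow : ℕ → Poly
qPow zero    = + 1 ∷ []
qPow (suc n) = shiftP (qPow n)

-- [c]_q = (1 - q^c)/(1 - q) = 1 + q + ... + q^(c-1)  (c ∈ ℕ)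
qInt : ℕ → Poly
qInt c = replicate c (+ 1)

_∣P_ : Poly → Poly → Set
d ∣P p = Σ Poly (λ e → p ≈P (d *P e))

-- Laurent polynomials in ℤ[q,q⁻¹]: (n , p) represents q^(-n) · p

Laurent : Set
Laurent = ℕ × Poly

-- q⁻¹ (L - S) for a Laurent polynomial L and a polynomial S
stepR : Laurent → Poly → Laurent
stepR (n , p) S = (suc n , p -P (qPow n *P S))

-- Negative continued fraction expansion of r/s > 1 (r > s ≥ 1):
-- r/s = c₁ - 1/(s/(c₁ s - r)) with c₁ = ⌈r/s⌉ ≥ 2.  The first argument
-- is fuel; the denominator strictly decreases, so fuel s+1 suffices.

negCF : ℕ → ℕ → ℕ → List ℕ
negCF zero       r s = []
negCF (suc fuel) r zero = []
negCF (suc fuel) r (suc s') with (r ℕ.+ s') / suc s'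
... | c with c ℕ.* suc s' ℕ.≟ r
...   | yes _ = c ∷ []
...   | no  _ = c ∷ negCF fuel (suc s') (c ℕ.* suc s' ∸ r)

-- M⁻_q(c) (a , b)ᵀ = ([c]_q a - q^(c-1) b , a)ᵀ
applyM : ℕ → Poly × Poly → Poly × Poly
applyM c (a , b) = ((qInt c *P a) -P (qPow (c ∸ 1) *P b) , a)

-- M⁻_q(c₁) ⋯ M⁻_q(c_l) (1 , 0)ᵀ
matProd : List ℕ → Poly × Poly
matProd cs = foldr applyM (+ 1 ∷ [] , []) cs

-- (R_{r/s}, S_{r/s}) for r > s ≥ 1
RSpos : ℕ → ℕ → Poly × Poly
RSpos r s = matProd (negCF (suc s) r s)

-- general rational r/s (s ≥ 1): recursive definition for α ≤ 1,
-- S_α = S_{α+1}, R_α = q⁻¹ (R_{α+1} - S_{α+1}).  First argument is fuel.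
RSfuel : ℕ → ℤ → ℕ → Laurent × Poly
RSfuel zero       r s = ((0 , []) , [])
RSfuel (suc fuel) r s with (+ s) ℤ.<? r
... | yes _ = let RS = RSpos ℤ.∣ r ∣ s in ((0 , proj₁ RS) , proj₂ RS)
... | no  _ = let RS = RSfuel fuel (r ℤ.+ + s) s in
              (stepR (proj₁ RS) (proj₂ RS) , proj₂ RS)

-- The number of shifts needed for r/s (s ≥ 1) is at most ∣r∣ + 2,
-- so this fuel is always sufficient.
RS : ℤ → ℕ → Laurent × Poly
RS r s = RSfuel (ℤ.∣ r ∣ ℕ.+ s ℕ.+ 3) r s

-- Eisenstein integers ℤ[ω] ⊂ ℂ, ω = (-1 + √-3)/2, ω² = -1 - ω.
-- (a , b) represents a + b ω.

ℤω : Set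
ℤω = ℤ × ℤ

_+ω_ : ℤω → ℤω → ℤω
(a , b) +ω (c , d) = (a ℤ.+ c , b ℤ.+ d)

mulω : ℤω → ℤω
mulω (a , b) = (- b , a - b)

-- multiplication by ω⁻¹ = ω²
mulω⁻¹ : ℤω → ℤω
mulω⁻¹ z = mulω (mulω z)

iter : {A : Set} → ℕ → (A → A) → A → A
iter zero    f x = x
iter (suc n) f x = f (iter n f x)

evalP : Poly → ℤω
evalP []      = (+ 0 , + 0)
evalP (a ∷ p) = (a , + 0) +ω mulω (evalP p)

evalL : Laurent → ℤω
evalL (n , p) = iter n mulω⁻¹ (evalP p)

zeroω oneω ωω ω²ω : ℤω
zeroω = (+ 0 , + 0)
oneω  = (+ 1 , + 0)
ωω    = (+ 0 , + 1)
ω²ω   = (- + 1 , - + 1)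

negω : ℤω → ℤω
negω (a , b) = (- a , - b)

InCubeRoots : ℤω → Set
InCubeRoots z = z ≡ oneω ⊎ z ≡ ωω ⊎ z ≡ ω²ω

InNegCubeRoots : ℤω → Set
InNegCubeRoots z = z ≡ negω oneω ⊎ z ≡ negω ωω ⊎ z ≡ negω ω²ω

-- Evaluation at q = 1 and at q = ω are ring maps out of ℤ[q]. At q = 1 the matrices M⁻_q(c)
-- become the integer matrices of the negative continued fraction, which run Euclid's algorithm
-- backwards, so (R(1), S(1)) = (r, s) when gcd(r, s) = 1. At q = ω the entries [c]_ω and ω^(c-1)
-- depend only on c mod 3, and the pair (R(ω), S(ω)) never leaves an explicit set of 24 pairs with
-- entries in {0, ±1, ±ω, ±ω²}; the shift α ↦ α - 1 preserves this set as well. The reduction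
-- a + bω ↦ a + b mod 3 of ℤ[ω] onto 𝔽₃ agrees with the value at q = 1 modulo 3, and on
-- {0, ±1, ±ω, ±ω²} it separates 0, the cube roots of unity and their negatives. Finally S(ω) = 0
-- means S is divisible by 1 + q + q², the minimal polynomial of ω.

module Submission where

open import Defs
open import Data.Nat as ℕ using (ℕ; zero; suc; _∸_; _/_; _%_; _<_; _≤_; s≤s; z≤n)
import Data.Nat.Properties as ℕP
open import Data.Nat.DivMod using (m≡m%n+[m/n]*n; m%n<n; m≥n⇒m/n>0)
open import Data.Nat.Divisibility using (_∣_; divides; n∣m⇒m%n≡0; >⇒∤)
open import Data.Nat.Coprimality using (Coprime; recompute)
open import Data.Integer as ℤ using (ℤ; +_; -_; _-_; -[1+_]; +<+; _⊖_; _/ℕ_)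
import Data.Integer.Properties as ℤP
open import Data.Integer.DivMod using (_%ℕ_; a≡a%ℕn+[a/ℕn]*n; n%ℕd<d)
open import Data.Integer.Divisibility.Signed as ℤ∣ using (∣-refl; ∣m∣n⇒∣m-n; ∣m∣n⇒∣m+n; ∣n⇒∣m*n; ∣⇒∣ᵤ)
open import Data.Integer.Solver using (module +-*-Solver)
open +-*-Solver using (solve; _:=_; _:+_; _:*_; :-_; _:-_; con)
open import Data.Rational using (ℚ; ↥_; ↧ₙ_; mkℚ)
open import Data.List using (List; []; _∷_; map; _++_; concatMap)
open import Data.List.Relation.Unary.All as All using (All; []; _∷_; all?)
open import Data.List.Relation.Unary.Any using (here; there)
open import Data.List.Membership.Propositional using (_∈_)
open import Data.Product using (_×_; _,_; proj₁; proj₂; ∃-syntax)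
open import Data.Product.Properties using (≡-dec)
open import Data.Sum using (_⊎_; inj₁; inj₂)
open import Data.Empty using (⊥; ⊥-elim)
open import Function using (_∘_)
open import Relation.Nullary using (yes; no)
open import Relation.Nullary.Decidable using (True; toWitness)
open import Relation.Binary.Definitions using (DecidableEquality)
open import Relation.Binary.PropositionalEquality

iter-suc : ∀ {A : Set} n (f : A → A) x → iter (suc n) f x ≡ iter n f (f x)
iter-suc zero    f x = refl
iter-suc (suc n) f x = cong f (iter-suc n f x)

iter-inverse : ∀ {A : Set} {f g : A → A} → (∀ x → g (f x) ≡ x) → ∀ n x → iter n g (iter n f x) ≡ x
iter-inverse         g∘f≗id zero    x = refl
iter-inverse {f = f} {g} g∘f≗id (suc n) x = begin
    g (iter n g (f (iter n f x)))   ≡⟨ iter-suc n g _ ⟩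
    iter n g (g (f (iter n f x)))   ≡⟨ cong (iter n g) (g∘f≗id _) ⟩
    iter n g (iter n f x)           ≡⟨ iter-inverse g∘f≗id n x ⟩
    x                               ∎
  where open ≡-Reasoning

iter-homo₁ : ∀ {A : Set} {f h : A → A} → (∀ x → f (h x) ≡ h (f x)) → ∀ n x → iter n f (h x) ≡ h (iter n f x)
iter-homo₁                 f∘h≗h∘f zero    x = refl
iter-homo₁ {f = f} {h = h} f∘h≗h∘f (suc n) x =
  trans (cong f (iter-homo₁ {h = h} f∘h≗h∘f n x)) (f∘h≗h∘f (iter n f x))

iter-homo₂ : ∀ {A : Set} {f : A → A} {_∙_ : A → A → A} → (∀ x y → f (x ∙ y) ≡ f x ∙ f y) →
             ∀ n x y → iter n f (x ∙ y) ≡ iter n f x ∙ iter n f y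
iter-homo₂                          f-homo zero    x y = refl
iter-homo₂ {f = f} {_∙_ = _∙_} f-homo (suc n) x y =
  trans (cong f (iter-homo₂ {_∙_ = _∙_} f-homo n x y)) (f-homo (iter n f x) (iter n f y))

-- Arithmetic of ℤ[ω] and evaluation at q = ω

-- (a + bω)(c + dω) = ac + (ad + bc) ω + bd ω², and ω² = -1 - ω.
infixl 30 _*ω_
_*ω_ : ℤω → ℤω → ℤω
(a , b) *ω (c , d) = (a ℤ.* c - b ℤ.* d , a ℤ.* d ℤ.+ b ℤ.* c - b ℤ.* d)

ℤω-≡ : ∀ {a b c d : ℤ} → a ≡ c → b ≡ d → (a , b) ≡ (c , d)
ℤω-≡ = cong₂ _,_

+ω-identityˡ : ∀ z → zeroω +ω z ≡ z
+ω-identityˡ (a , b) = ℤω-≡ (ℤP.+-identityˡ a) (ℤP.+-identityˡ b)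

+ω-identityʳ : ∀ z → z +ω zeroω ≡ z
+ω-identityʳ (a , b) = ℤω-≡ (ℤP.+-identityʳ a) (ℤP.+-identityʳ b)

mulω-+ω : ∀ z w → mulω (z +ω w) ≡ mulω z +ω mulω w
mulω-+ω (a , b) (c , d) = ℤω-≡
  (solve 2 (λ b d → :- (b :+ d) := :- b :+ :- d) refl b d)
  (solve 4 (λ a b c d → (a :+ c) :- (b :+ d) := (a :- b) :+ (c :- d)) refl a b c d)

mulω-negω : ∀ z → mulω (negω z) ≡ negω (mulω z)
mulω-negω (a , b) = ℤω-≡ refl (solve 2 (λ a b → :- a :- :- b := :- (a :- b)) refl a b)

mulω³ : ∀ z → mulω (mulω (mulω z)) ≡ z
mulω³ (a , b) = ℤω-≡
  (solve 2 (λ a b → :- (:- b :- (a :- b)) := a) refl a b)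
  (solve 2 (λ a b → :- (a :- b) :- (:- b :- (a :- b)) := b) refl a b)

mulω-*ω : ∀ z w → mulω z *ω w ≡ mulω (z *ω w)
mulω-*ω (a , b) (c , d) = ℤω-≡
  (solve 4 (λ a b c d → :- b :* c :- (a :- b) :* d := :- (a :* d :+ b :* c :- b :* d)) refl a b c d)
  (solve 4 (λ a b c d → :- b :* d :+ (a :- b) :* c :- (a :- b) :* d
                        := (a :* c :- b :* d) :- (a :* d :+ b :* c :- b :* d)) refl a b c d)

*ω-identityˡ : ∀ z → oneω *ω z ≡ z
*ω-identityˡ (c , d) = ℤω-≡
  (solve 2 (λ c d → con (+ 1) :* c :- con (+ 0) :* d := c) refl c d)
  (solve 2 (λ c d → con (+ 1) :* d :+ con (+ 0) :* c :- con (+ 0) :* d := d) refl c d)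

*ω-zeroˡ : ∀ z → zeroω *ω z ≡ zeroω
*ω-zeroˡ (c , d) = ℤω-≡
  (solve 2 (λ c d → con (+ 0) :* c :- con (+ 0) :* d := con (+ 0)) refl c d)
  (solve 2 (λ c d → con (+ 0) :* d :+ con (+ 0) :* c :- con (+ 0) :* d := con (+ 0)) refl c d)

*ω-zeroʳ : ∀ z → z *ω zeroω ≡ zeroω
*ω-zeroʳ (a , b) = ℤω-≡
  (solve 2 (λ a b → a :* con (+ 0) :- b :* con (+ 0) := con (+ 0)) refl a b)
  (solve 2 (λ a b → a :* con (+ 0) :+ b :* con (+ 0) :- b :* con (+ 0) := con (+ 0)) refl a b)

evalP-+P : ∀ p p' → evalP (p +P p') ≡ evalP p +ω evalP p'
evalP-+P []      p'       = sym (+ω-identityˡ (evalP p'))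
evalP-+P (a ∷ p) []       = sym (+ω-identityʳ (evalP (a ∷ p)))
evalP-+P (a ∷ p) (b ∷ p') =
  trans (cong (λ w → (a ℤ.+ b , + 0) +ω mulω w) (evalP-+P p p')) (horner-+ (evalP p) (evalP p'))
  where
  horner-+ : ∀ z w → (a ℤ.+ b , + 0) +ω mulω (z +ω w) ≡ ((a , + 0) +ω mulω z) +ω ((b , + 0) +ω mulω w)
  horner-+ (x , y) (x' , y') = ℤω-≡
    (solve 4 (λ a b y y' → (a :+ b) :+ :- (y :+ y') := (a :+ :- y) :+ (b :+ :- y')) refl a b y y')
    (solve 4 (λ x y x' y' → con (+ 0) :+ ((x :+ x') :- (y :+ y'))
                            := (con (+ 0) :+ (x :- y)) :+ (con (+ 0) :+ (x' :- y'))) refl x y x' y')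

evalP-negP : ∀ p → evalP (negP p) ≡ negω (evalP p)
evalP-negP []      = refl
evalP-negP (a ∷ p) = trans (cong (λ w → (- a , + 0) +ω mulω w) (evalP-negP p)) (horner-neg (evalP p))
  where
  horner-neg : ∀ z → (- a , + 0) +ω mulω (negω z) ≡ negω ((a , + 0) +ω mulω z)
  horner-neg (x , y) = ℤω-≡
    (solve 2 (λ a y → :- a :+ :- (:- y) := :- (a :+ :- y)) refl a y)
    (solve 2 (λ x y → con (+ 0) :+ (:- x :- :- y) := :- (con (+ 0) :+ (x :- y))) refl x y)

evalP-·P : ∀ a p → evalP (a ·P p) ≡ (a , + 0) *ω evalP p
evalP-·P a []      = sym (*ω-zeroʳ (a , + 0))
evalP-·P a (b ∷ p) = trans (cong (λ w → (a ℤ.* b , + 0) +ω mulω w) (evalP-·P a p)) (horner-· (evalP p))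
  where
  horner-· : ∀ z → (a ℤ.* b , + 0) +ω mulω ((a , + 0) *ω z) ≡ (a , + 0) *ω ((b , + 0) +ω mulω z)
  horner-· (x , y) = ℤω-≡
    (solve 4 (λ a b x y → a :* b :+ :- (a :* y :+ con (+ 0) :* x :- con (+ 0) :* y)
                          := a :* (b :+ :- y) :- con (+ 0) :* (con (+ 0) :+ (x :- y))) refl a b x y)
    (solve 4 (λ a b x y → con (+ 0) :+ ((a :* x :- con (+ 0) :* y) :- (a :* y :+ con (+ 0) :* x :- con (+ 0) :* y))
                          := a :* (con (+ 0) :+ (x :- y)) :+ con (+ 0) :* (b :+ :- y) :- con (+ 0) :* (con (+ 0) :+ (x :- y))) refl a b x y)

evalP-*P : ∀ p p' → evalP (p *P p') ≡ evalP p *ω evalP p'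
evalP-*P []      p' = sym (*ω-zeroˡ (evalP p'))
evalP-*P (a ∷ p) p' = begin
    evalP ((a ·P p') +P shiftP (p *P p'))
  ≡⟨ evalP-+P (a ·P p') (shiftP (p *P p')) ⟩
    evalP (a ·P p') +ω ((+ 0 , + 0) +ω mulω (evalP (p *P p')))
  ≡⟨ cong₂ (λ u v → u +ω ((+ 0 , + 0) +ω mulω v)) (evalP-·P a p') (evalP-*P p p') ⟩
    (a , + 0) *ω evalP p' +ω ((+ 0 , + 0) +ω mulω (evalP p *ω evalP p'))
  ≡⟨ horner-* (evalP p) (evalP p') ⟩
    ((a , + 0) +ω mulω (evalP p)) *ω evalP p'
  ∎
  where
  open ≡-Reasoning
  horner-* : ∀ z w → (a , + 0) *ω w +ω ((+ 0 , + 0) +ω mulω (z *ω w)) ≡ ((a , + 0) +ω mulω z) *ω w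
  horner-* (x , y) (c , d) = ℤω-≡
    (solve 5 (λ a x y c d → (a :* c :- con (+ 0) :* d) :+ (con (+ 0) :+ :- (x :* d :+ y :* c :- y :* d))
                            := (a :+ :- y) :* c :- (con (+ 0) :+ (x :- y)) :* d) refl a x y c d)
    (solve 5 (λ a x y c d → (a :* d :+ con (+ 0) :* c :- con (+ 0) :* d) :+ (con (+ 0) :+ ((x :* c :- y :* d) :- (x :* d :+ y :* c :- y :* d)))
                            := (a :+ :- y) :* d :+ (con (+ 0) :+ (x :- y)) :* c :- (con (+ 0) :+ (x :- y)) :* d) refl a x y c d)

mulω⁻¹-+ω : ∀ z w → mulω⁻¹ (z +ω w) ≡ mulω⁻¹ z +ω mulω⁻¹ w
mulω⁻¹-+ω z w = trans (cong mulω (mulω-+ω z w)) (mulω-+ω (mulω z) (mulω w))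

mulω⁻¹-negω : ∀ z → mulω⁻¹ (negω z) ≡ negω (mulω⁻¹ z)
mulω⁻¹-negω z = trans (cong mulω (mulω-negω z)) (mulω-negω (mulω z))

evalP-qPow-suc : ∀ n → evalP (qPow (suc n)) ≡ mulω (evalP (qPow n))
evalP-qPow-suc n = +ω-identityˡ (mulω (evalP (qPow n)))

evalP-qPow-*P : ∀ n p → evalP (qPow n *P p) ≡ iter n mulω (evalP p)
evalP-qPow-*P n p = trans (evalP-*P (qPow n) p) (qPow-*ω n (evalP p))
  where
  qPow-*ω : ∀ n z → evalP (qPow n) *ω z ≡ iter n mulω z
  qPow-*ω zero    z = *ω-identityˡ z
  qPow-*ω (suc n) z = begin
      evalP (qPow (suc n)) *ω z               ≡⟨ cong (_*ω z) (evalP-qPow-suc n) ⟩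
      mulω (evalP (qPow n)) *ω z              ≡⟨ mulω-*ω (evalP (qPow n)) z ⟩
      mulω (evalP (qPow n) *ω z)              ≡⟨ cong mulω (qPow-*ω n z) ⟩
      mulω (iter n mulω z)                    ∎
    where open ≡-Reasoning

evalL-stepR : ∀ L S → evalL (stepR L S) ≡ mulω⁻¹ (evalL L +ω negω (evalP S))
evalL-stepR (n , p) S = cong mulω⁻¹ (begin
    iter n mulω⁻¹ (evalP (p -P (qPow n *P S)))
  ≡⟨ cong (iter n mulω⁻¹) (evalP-+P p (negP (qPow n *P S))) ⟩
    iter n mulω⁻¹ (evalP p +ω evalP (negP (qPow n *P S)))
  ≡⟨ cong (λ w → iter n mulω⁻¹ (evalP p +ω w)) (trans (evalP-negP (qPow n *P S)) (cong negω (evalP-qPow-*P n S))) ⟩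
    iter n mulω⁻¹ (evalP p +ω negω (iter n mulω (evalP S)))
  ≡⟨ iter-homo₂ {_∙_ = _+ω_} mulω⁻¹-+ω n _ _ ⟩
    iter n mulω⁻¹ (evalP p) +ω iter n mulω⁻¹ (negω (iter n mulω (evalP S)))
  ≡⟨ cong (iter n mulω⁻¹ (evalP p) +ω_) (iter-homo₁ {h = negω} mulω⁻¹-negω n _) ⟩
    iter n mulω⁻¹ (evalP p) +ω negω (iter n mulω⁻¹ (iter n mulω (evalP S)))
  ≡⟨ cong (λ w → iter n mulω⁻¹ (evalP p) +ω negω w) (iter-inverse mulω³ n (evalP S)) ⟩
    iter n mulω⁻¹ (evalP p) +ω negω (evalP S)
  ∎)
  where open ≡-Reasoning

evalP-qPow-periodic : ∀ n → evalP (qPow (3 ℕ.+ n)) ≡ evalP (qPow n)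
evalP-qPow-periodic n = begin
    evalP (qPow (3 ℕ.+ n))                    ≡⟨ evalP-qPow-suc (2 ℕ.+ n) ⟩
    mulω (evalP (qPow (2 ℕ.+ n)))             ≡⟨ cong mulω (evalP-qPow-suc (suc n)) ⟩
    mulω (mulω (evalP (qPow (suc n))))        ≡⟨ cong (mulω ∘ mulω) (evalP-qPow-suc n) ⟩
    mulω (mulω (mulω (evalP (qPow n))))       ≡⟨ mulω³ (evalP (qPow n)) ⟩
    evalP (qPow n)                            ∎
  where open ≡-Reasoning

-- 1 + ω + ω² = 0
evalP-qInt-periodic : ∀ c → evalP (qInt (3 ℕ.+ c)) ≡ evalP (qInt c)
evalP-qInt-periodic c = horner-[3] (evalP (qInt c))
  where
  horner-[3] : ∀ z → oneω +ω mulω (oneω +ω mulω (oneω +ω mulω z)) ≡ z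
  horner-[3] (a , b) = ℤω-≡
    (solve 2 (λ a b → con (+ 1) :+ :- (con (+ 0) :+ ((con (+ 1) :+ :- b) :- (con (+ 0) :+ (a :- b)))) := a) refl a b)
    (solve 2 (λ a b → con (+ 0) :+ ((con (+ 1) :+ :- (con (+ 0) :+ (a :- b)))
                         :- (con (+ 0) :+ ((con (+ 1) :+ :- b) :- (con (+ 0) :+ (a :- b))))) := b) refl a b)

-- The values at q = ω stay in a finite set

evalP₂ : Poly × Poly → ℤω × ℤω
evalP₂ (a , b) = (evalP a , evalP b)

entriesω : ℕ → ℤω × ℤω
entriesω c = (evalP (qInt c) , evalP (qPow (c ∸ 1)))

stepω : ℤω × ℤω → ℤω × ℤω → ℤω × ℤω
stepω (u , v) (a , b) = (u *ω a +ω negω (v *ω b) , a)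

evalP₂-applyM : ∀ c x → evalP₂ (applyM c x) ≡ stepω (entriesω c) (evalP₂ x)
evalP₂-applyM c (a , b) = cong (_, evalP a) (begin
    evalP ((qInt c *P a) +P negP (qPow (c ∸ 1) *P b))
  ≡⟨ evalP-+P (qInt c *P a) (negP (qPow (c ∸ 1) *P b)) ⟩
    evalP (qInt c *P a) +ω evalP (negP (qPow (c ∸ 1) *P b))
  ≡⟨ cong₂ _+ω_ (evalP-*P (qInt c) a) (trans (evalP-negP (qPow (c ∸ 1) *P b)) (cong negω (evalP-*P (qPow (c ∸ 1)) b))) ⟩
    evalP (qInt c) *ω evalP a +ω negω (evalP (qPow (c ∸ 1)) *ω evalP b)
  ∎)
  where open ≡-Reasoning

entriesω-cases : ∀ c → entriesω (suc c) ≡ (oneω , oneω)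
                     ⊎ entriesω (suc c) ≡ ((+ 1 , + 1) , ωω)
                     ⊎ entriesω (suc c) ≡ (zeroω , ω²ω)
entriesω-cases 0 = inj₁ refl
entriesω-cases 1 = inj₂ (inj₁ refl)
entriesω-cases 2 = inj₂ (inj₂ refl)
entriesω-cases (suc (suc (suc c)))
  rewrite evalP-qInt-periodic (suc c) | evalP-qPow-periodic c = entriesω-cases c

shiftω : ℤω × ℤω → ℤω × ℤω
shiftω (a , b) = (mulω⁻¹ (a +ω negω b) , b)

_≟ω_ : DecidableEquality ℤω
_≟ω_ = ≡-dec ℤ._≟_ ℤ._≟_

_≟ω₂_ : DecidableEquality (ℤω × ℤω)
_≟ω₂_ = ≡-dec _≟ω_ _≟ω_

open import Data.List.Membership.DecPropositional _≟ω₂_ using (_∈?_)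
open import Data.List.Membership.DecPropositional _≟ω_ using () renaming (_∈?_ to _∈ω?_)

units : List ℤω
units = oneω ∷ ωω ∷ ω²ω ∷ negω oneω ∷ negω ωω ∷ negω ω²ω ∷ []

orbit : List (ℤω × ℤω)
orbit = map (zeroω ,_) units
     ++ concatMap (λ u → (u , zeroω) ∷ (u , u) ∷ (u , negω (mulω u)) ∷ []) units

orbit-closed : (f : ℤω × ℤω → ℤω × ℤω) → {True (all? (λ x → f x ∈? orbit) orbit)} →
               ∀ {x} → x ∈ orbit → f x ∈ orbit
orbit-closed f {closed} = All.lookup (toWitness closed)

stepω-closed : ∀ c {x} → x ∈ orbit → stepω (entriesω (suc c)) x ∈ orbit
stepω-closed c {x} x∈orbit with entriesω-cases c
... | inj₁ e        = subst (λ m → stepω m x ∈ orbit) (sym e) (orbit-closed (stepω (oneω , oneω)) x∈orbit)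
... | inj₂ (inj₁ e) = subst (λ m → stepω m x ∈ orbit) (sym e) (orbit-closed (stepω ((+ 1 , + 1) , ωω)) x∈orbit)
... | inj₂ (inj₂ e) = subst (λ m → stepω m x ∈ orbit) (sym e) (orbit-closed (stepω (zeroω , ω²ω)) x∈orbit)

shiftω-closed : ∀ {x} → x ∈ orbit → shiftω x ∈ orbit
shiftω-closed = orbit-closed shiftω

matProd-∈-orbit : ∀ cs → All (1 ≤_) cs → evalP₂ (matProd cs) ∈ orbit
matProd-∈-orbit []             []             = toWitness {a? = (oneω , zeroω) ∈? orbit} _
matProd-∈-orbit (suc c ∷ cs) (s≤s _ ∷ cs≥1) =
  subst (_∈ orbit) (sym (evalP₂-applyM (suc c) (matProd cs))) (stepω-closed c (matProd-∈-orbit cs cs≥1))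

orbit-values : ∀ {x} → x ∈ orbit → (proj₁ x ∈ zeroω ∷ units) × (proj₂ x ∈ zeroω ∷ units)
orbit-values x∈orbit =
  All.lookup (toWitness {a? = all? (λ x → proj₁ x ∈ω? zeroω ∷ units) orbit} _) x∈orbit ,
  All.lookup (toWitness {a? = all? (λ x → proj₂ x ∈ω? zeroω ∷ units) orbit} _) x∈orbit

-- Evaluation at q = 1 and the negative continued fraction

evalOne : Poly → ℤ
evalOne []      = + 0
evalOne (a ∷ p) = a ℤ.+ evalOne p

evalOne-+P : ∀ p p' → evalOne (p +P p') ≡ evalOne p ℤ.+ evalOne p'
evalOne-+P []      p'       = sym (ℤP.+-identityˡ (evalOne p'))
evalOne-+P (a ∷ p) []       = sym (ℤP.+-identityʳ (evalOne (a ∷ p)))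
evalOne-+P (a ∷ p) (b ∷ p') = trans (cong (λ w → (a ℤ.+ b) ℤ.+ w) (evalOne-+P p p'))
  (solve 4 (λ a b x y → (a :+ b) :+ (x :+ y) := (a :+ x) :+ (b :+ y)) refl a b (evalOne p) (evalOne p'))

evalOne-negP : ∀ p → evalOne (negP p) ≡ - evalOne p
evalOne-negP []      = refl
evalOne-negP (a ∷ p) = trans (cong (λ w → - a ℤ.+ w) (evalOne-negP p)) (sym (ℤP.neg-distrib-+ a (evalOne p)))

evalOne-·P : ∀ a p → evalOne (a ·P p) ≡ a ℤ.* evalOne p
evalOne-·P a []      = sym (ℤP.*-zeroʳ a)
evalOne-·P a (b ∷ p) = trans (cong (λ w → a ℤ.* b ℤ.+ w) (evalOne-·P a p)) (sym (ℤP.*-distribˡ-+ a b (evalOne p)))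

evalOne-*P : ∀ p p' → evalOne (p *P p') ≡ evalOne p ℤ.* evalOne p'
evalOne-*P []      p' = refl
evalOne-*P (a ∷ p) p' = begin
    evalOne ((a ·P p') +P shiftP (p *P p'))
  ≡⟨ evalOne-+P (a ·P p') (shiftP (p *P p')) ⟩
    evalOne (a ·P p') ℤ.+ (+ 0 ℤ.+ evalOne (p *P p'))
  ≡⟨ cong₂ (λ u v → u ℤ.+ (+ 0 ℤ.+ v)) (evalOne-·P a p') (evalOne-*P p p') ⟩
    a ℤ.* evalOne p' ℤ.+ (+ 0 ℤ.+ evalOne p ℤ.* evalOne p')
  ≡⟨ solve 3 (λ a x y → a :* y :+ (con (+ 0) :+ x :* y) := (a :+ x) :* y) refl a (evalOne p) (evalOne p') ⟩
    (a ℤ.+ evalOne p) ℤ.* evalOne p'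
  ∎
  where open ≡-Reasoning

evalOne-qInt : ∀ c → evalOne (qInt c) ≡ + c
evalOne-qInt zero    = refl
evalOne-qInt (suc c) = cong (λ w → + 1 ℤ.+ w) (evalOne-qInt c)

evalOne-qPow-*P : ∀ n p → evalOne (qPow n *P p) ≡ evalOne p
evalOne-qPow-*P n p = trans (evalOne-*P (qPow n) p) (trans (cong (ℤ._* evalOne p) (qPow-at-1 n)) (ℤP.*-identityˡ _))
  where
  qPow-at-1 : ∀ n → evalOne (qPow n) ≡ + 1
  qPow-at-1 zero    = refl
  qPow-at-1 (suc n) = cong (λ w → + 0 ℤ.+ w) (qPow-at-1 n)

evalOne₂ : Poly × Poly → ℤ × ℤ
evalOne₂ (a , b) = (evalOne a , evalOne b)

evalOne₂-applyM : ∀ c a b → evalOne₂ (applyM c (a , b)) ≡ (+ c ℤ.* evalOne a - evalOne b , evalOne a)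
evalOne₂-applyM c a b = cong (_, evalOne a) (begin
    evalOne ((qInt c *P a) +P negP (qPow (c ∸ 1) *P b))
  ≡⟨ evalOne-+P (qInt c *P a) (negP (qPow (c ∸ 1) *P b)) ⟩
    evalOne (qInt c *P a) ℤ.+ evalOne (negP (qPow (c ∸ 1) *P b))
  ≡⟨ cong₂ ℤ._+_ (trans (evalOne-*P (qInt c) a) (cong (ℤ._* evalOne a) (evalOne-qInt c)))
                 (trans (evalOne-negP (qPow (c ∸ 1) *P b)) (cong -_ (evalOne-qPow-*P (c ∸ 1) b))) ⟩
    + c ℤ.* evalOne a - evalOne b
  ∎)
  where open ≡-Reasoning

evalOne-stepR : ∀ L S → evalOne (proj₂ (stepR L S)) ≡ evalOne (proj₂ L) - evalOne S
evalOne-stepR (n , p) S = trans (evalOne-+P p (negP (qPow n *P S)))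
  (cong (λ w → evalOne p ℤ.+ w) (trans (evalOne-negP (qPow n *P S)) (cong -_ (evalOne-qPow-*P n S))))

infix 4 _IsMultipleOf_
_IsMultipleOf_ : ℤ × ℤ → ℤ × ℤ → Set
(u , v) IsMultipleOf (a , b) = ∃[ k ] u ≡ + k ℤ.* a × v ≡ + k ℤ.* b

IsMultipleOf-step : ∀ c {u v a b} → (u , v) IsMultipleOf (a , b) →
                    (c ℤ.* u - v , u) IsMultipleOf (c ℤ.* a - b , a)
IsMultipleOf-step c {a = a} {b} (k , refl , refl) =
  k , solve 4 (λ c k a b → c :* (k :* a) :- k :* b := k :* (c :* a :- b)) refl c (+ k) a b , refl

IsMultipleOf-shift : ∀ {u v a b} → (u ℤ.+ v , v) IsMultipleOf (a , b) → (u , v) IsMultipleOf (a - b , b)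
IsMultipleOf-shift {u} {v} {a} {b} (k , u+v≡ka , v≡kb) = k , (begin
    u                           ≡⟨ solve 2 (λ u v → u := (u :+ v) :- v) refl u v ⟩
    (u ℤ.+ v) - v               ≡⟨ cong₂ _-_ u+v≡ka v≡kb ⟩
    + k ℤ.* a - + k ℤ.* b       ≡⟨ solve 3 (λ k a b → k :* a :- k :* b := k :* (a :- b)) refl (+ k) a b ⟩
    + k ℤ.* (a - b)             ∎) , v≡kb
  where open ≡-Reasoning

-- negCF computes ⌈m / (1 + n)⌉ as (m + n) / (1 + n).
m≤⌈m/n⌉*n : ∀ m n → m ≤ (m ℕ.+ n) / suc n ℕ.* suc n
m≤⌈m/n⌉*n m n = ℕP.+-cancelʳ-≤ n m _ (begin
    m ℕ.+ n                                       ≡⟨ m≡m%n+[m/n]*n (m ℕ.+ n) (suc n) ⟩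
    (m ℕ.+ n) ℕ.% suc n ℕ.+ (m ℕ.+ n) / suc n ℕ.* suc n
                                                  ≤⟨ ℕP.+-monoˡ-≤ _ (ℕP.≤-pred (m%n<n (m ℕ.+ n) (suc n))) ⟩
    n ℕ.+ (m ℕ.+ n) / suc n ℕ.* suc n             ≡⟨ ℕP.+-comm n _ ⟩
    (m ℕ.+ n) / suc n ℕ.* suc n ℕ.+ n             ∎)
  where open ℕP.≤-Reasoning

⌈m/n⌉*n∸m≤n : ∀ m n → (m ℕ.+ n) / suc n ℕ.* suc n ∸ m ≤ n
⌈m/n⌉*n∸m≤n m n = begin
    (m ℕ.+ n) / suc n ℕ.* suc n ∸ m                              ≤⟨ ℕP.∸-monoˡ-≤ m (ℕP.m≤n+m _ _) ⟩
    (m ℕ.+ n) ℕ.% suc n ℕ.+ (m ℕ.+ n) / suc n ℕ.* suc n ∸ m     ≡⟨ cong (_∸ m) (m≡m%n+[m/n]*n (m ℕ.+ n) (suc n)) ⟨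
    m ℕ.+ n ∸ m                                                  ≡⟨ ℕP.m+n∸m≡n m n ⟩
    n                                                            ∎
  where open ℕP.≤-Reasoning

⌈m/n⌉>0 : ∀ m n → 1 ≤ m → 1 ≤ (m ℕ.+ n) / suc n
⌈m/n⌉>0 m n 1≤m = m≥n⇒m/n>0 (ℕP.+-monoˡ-≤ n 1≤m)

negCF-positive : ∀ fuel r s → 1 ≤ r → All (1 ≤_) (negCF fuel r s)
negCF-positive zero       r s        1≤r = []
negCF-positive (suc fuel) r zero     1≤r = []
negCF-positive (suc fuel) r (suc s') 1≤r with (r ℕ.+ s') / suc s' in c≡
... | c with c ℕ.* suc s' ℕ.≟ r
...   | yes _ = subst (1 ≤_) c≡ (⌈m/n⌉>0 r s' 1≤r) ∷ []
...   | no  _ = subst (1 ≤_) c≡ (⌈m/n⌉>0 r s' 1≤r) ∷ negCF-positive fuel (suc s') (c ℕ.* suc s' ∸ r) (s≤s z≤n)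

-- At q = 1, M⁻(c) maps (s, cs - r) to (r, s): a step of the continued fraction read backwards.
IsMultipleOf-applyM : ∀ c r s x → r ≤ c ℕ.* s →
                      (+ s , + (c ℕ.* s ∸ r)) IsMultipleOf evalOne₂ x →
                      (+ r , + s) IsMultipleOf evalOne₂ (applyM c x)
IsMultipleOf-applyM c r s (a , b) r≤cs multiple =
  subst₂ (λ u w → (u , + s) IsMultipleOf w) c*s-[c*s∸r]≡r (sym (evalOne₂-applyM c a b))
         (IsMultipleOf-step (+ c) multiple)
  where
  c*s-[c*s∸r]≡r : + c ℤ.* + s - + (c ℕ.* s ∸ r) ≡ + r
  c*s-[c*s∸r]≡r = begin
      + c ℤ.* + s - + (c ℕ.* s ∸ r)              ≡⟨ cong (_- + (c ℕ.* s ∸ r)) (ℤP.pos-* c s) ⟨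
      + (c ℕ.* s) - + (c ℕ.* s ∸ r)              ≡⟨ cong (λ x → + x - + (c ℕ.* s ∸ r)) (ℕP.m+[n∸m]≡n r≤cs) ⟨
      + (r ℕ.+ (c ℕ.* s ∸ r)) - + (c ℕ.* s ∸ r)  ≡⟨ cong (_- + (c ℕ.* s ∸ r)) (ℤP.pos-+ r _) ⟩
      + r ℤ.+ + (c ℕ.* s ∸ r) - + (c ℕ.* s ∸ r)  ≡⟨ solve 2 (λ r t → r :+ t :- t := r) refl (+ r) (+ (c ℕ.* s ∸ r)) ⟩
      + r                                        ∎
    where open ≡-Reasoning

negCF-at-1 : ∀ fuel r s → 1 ≤ s → s ≤ fuel → (+ r , + s) IsMultipleOf evalOne₂ (matProd (negCF fuel r s))
negCF-at-1 (suc fuel) r (suc s') _ s≤fuel with (r ℕ.+ s') / suc s' in c≡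
... | c with c ℕ.* suc s' ℕ.≟ r
...   | yes cs≡r = IsMultipleOf-applyM c r (suc s') _ (ℕP.≤-reflexive (sym cs≡r))
                     (suc s' , sym (ℤP.*-identityʳ (+ suc s')) , cs∸r≡s*0)
  where
  cs∸r≡s*0 : + (c ℕ.* suc s' ∸ r) ≡ + suc s' ℤ.* + 0
  cs∸r≡s*0 = trans (cong (λ x → + (x ∸ r)) cs≡r) (trans (cong +_ (ℕP.n∸n≡0 r)) (sym (ℤP.*-zeroʳ (+ suc s'))))
...   | no  cs≢r = IsMultipleOf-applyM c r (suc s') _ r≤cs
                     (negCF-at-1 fuel (suc s') (c ℕ.* suc s' ∸ r) 1≤cs∸r cs∸r≤fuel)
  where
  r≤cs : r ≤ c ℕ.* suc s'
  r≤cs = subst (λ x → r ≤ x ℕ.* suc s') c≡ (m≤⌈m/n⌉*n r s')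
  1≤cs∸r : 1 ≤ c ℕ.* suc s' ∸ r
  1≤cs∸r = ℕP.m<n⇒0<n∸m (ℕP.≤∧≢⇒< r≤cs (cs≢r ∘ sym))
  cs∸r≤fuel : c ℕ.* suc s' ∸ r ≤ fuel
  cs∸r≤fuel = ℕP.≤-trans (subst (λ x → x ℕ.* suc s' ∸ r ≤ s') c≡ (⌈m/n⌉*n∸m≤n r s')) (ℕP.≤-pred s≤fuel)

module RS-Induction (P : ℤ → Laurent × Poly → Set) {s : ℕ} (1≤s : 1 ≤ s)
  (P-RSpos : ∀ n → s < n → P (+ n) ((0 , proj₁ (RSpos n s)) , proj₂ (RSpos n s)))
  (P-stepR : ∀ r L S → P (r ℤ.+ + s) (L , S) → P r (stepR L S , S))
  where

  RSfuel-induction : ∀ f r → + s ℤ.< r ℤ.+ + f → P r (RSfuel (suc f) r s)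
  RSfuel-induction f r s<r+f with + s ℤ.<? r
  RSfuel-induction f       .(+ n) _     | yes (+<+ {n = n} s<n) = P-RSpos n s<n
  RSfuel-induction zero    r      s<r+0 | no  s≮r = ⊥-elim (s≮r (subst (λ x → + s ℤ.< x) (ℤP.+-identityʳ r) s<r+0))
  RSfuel-induction (suc f) r      s<r+f | no  s≮r =
    P-stepR r _ _ (RSfuel-induction f (r ℤ.+ + s) (ℤP.<-≤-trans s<r+f r+[1+f]≤[r+s]+f))
    where
    r+[1+f]≤[r+s]+f : r ℤ.+ (+ 1 ℤ.+ + f) ℤ.≤ (r ℤ.+ + s) ℤ.+ + f
    r+[1+f]≤[r+s]+f = ℤP.≤-trans (ℤP.+-monoʳ-≤ r (ℤP.+-monoˡ-≤ (+ f) (ℤ.+≤+ 1≤s)))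
                                 (ℤP.≤-reflexive (sym (ℤP.+-assoc r (+ s) (+ f))))

  fuel-suffices : ∀ r → + s ℤ.< r ℤ.+ + (ℤ.∣ r ∣ ℕ.+ s ℕ.+ 2)
  fuel-suffices r = begin-strict
      + s                                  <⟨ +<+ (ℕP.m<m+n s (s≤s z≤n)) ⟩
      + (s ℕ.+ 2)                          ≤⟨ ℤP.+-monoˡ-≤ (+ (s ℕ.+ 2)) (0≤r+∣r∣ r) ⟩
      (r ℤ.+ + ℤ.∣ r ∣) ℤ.+ + (s ℕ.+ 2)    ≡⟨ ℤP.+-assoc r _ _ ⟩
      r ℤ.+ (+ ℤ.∣ r ∣ ℤ.+ + (s ℕ.+ 2))    ≡⟨ cong (λ x → r ℤ.+ x) (ℤP.pos-+ ℤ.∣ r ∣ (s ℕ.+ 2)) ⟨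
      r ℤ.+ + (ℤ.∣ r ∣ ℕ.+ (s ℕ.+ 2))      ≡⟨ cong (λ x → r ℤ.+ + x) (ℕP.+-assoc ℤ.∣ r ∣ s 2) ⟨
      r ℤ.+ + (ℤ.∣ r ∣ ℕ.+ s ℕ.+ 2)        ∎
    where
    open ℤP.≤-Reasoning
    0≤r+∣r∣ : ∀ r → + 0 ℤ.≤ r ℤ.+ + ℤ.∣ r ∣
    0≤r+∣r∣ (+ n)    = ℤ.+≤+ z≤n
    0≤r+∣r∣ -[1+ n ] = ℤP.≤-reflexive (sym (ℤP.+-inverseˡ (+ suc n)))

  RS-induction : ∀ r → P r (RS r s)
  RS-induction r = subst (λ f → P r (RSfuel f r s)) (sym (ℕP.+-suc (ℤ.∣ r ∣ ℕ.+ s) 2))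
                         (RSfuel-induction _ r (fuel-suffices r))

-- Congruences modulo 3

-- A record rather than a synonym, so that x and y remain inferable.
infix 4 _≡_mod_
record _≡_mod_ (x y : ℤ) (d : ℕ) : Set where
  constructor mod-by
  field divides-difference : + d ℤ∣.∣ x - y

mod-refl : ∀ {x d} → x ≡ x mod d
mod-refl {x} {d} = mod-by (ℤ∣.divides (+ 0) (trans (ℤP.+-inverseʳ x) (sym (ℤP.*-zeroˡ (+ d)))))

mod-trans : ∀ {x y z d} → x ≡ y mod d → y ≡ z mod d → x ≡ z mod d
mod-trans {x} {y} {z} (mod-by d∣x-y) (mod-by d∣y-z) =
  mod-by (subst (_ ℤ∣.∣_) (solve 3 (λ x y z → (x :- y) :+ (y :- z) := x :- z) refl x y z) (∣m∣n⇒∣m+n d∣x-y d∣y-z))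

mod-+ˡ : ∀ a {x y d} → x ≡ y mod d → a ℤ.+ x ≡ a ℤ.+ y mod d
mod-+ˡ a {x} {y} (mod-by d∣x-y) = mod-by (subst (_ ℤ∣.∣_) (solve 3 (λ a x y → x :- y := (a :+ x) :- (a :+ y)) refl a x y) d∣x-y)

n∣m<n⇒m≡0 : ∀ {n m} → n ∣ m → m < n → m ≡ 0
n∣m<n⇒m≡0 {m = zero}  _   _   = refl
n∣m<n⇒m≡0 {m = suc m} n∣m m<n = ⊥-elim (>⇒∤ m<n n∣m)

∣m⊖n∣<d : ∀ {m n d} → m < d → n < d → ℤ.∣ m ⊖ n ∣ < d
∣m⊖n∣<d {m} {n} m<d n<d with ℕP.≤-total m n
... | inj₁ m≤n = ℕP.≤-<-trans (ℕP.≤-reflexive (ℤP.∣⊖∣-≤ m≤n)) (ℕP.≤-<-trans (ℕP.m∸n≤m n m) n<d)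
... | inj₂ n≤m = ℕP.≤-<-trans (ℕP.≤-reflexive (trans (ℤP.∣m⊖n∣≡∣n⊖m∣ m n) (ℤP.∣⊖∣-≤ n≤m)))
                              (ℕP.≤-<-trans (ℕP.m∸n≤m m n) m<d)

%ℕ-cong : ∀ {x y} d .{{_ : ℕ.NonZero d}} → x ≡ y mod d → x %ℕ d ≡ y %ℕ d
%ℕ-cong {x} {y} d (mod-by d∣x-y) = ℤP.+-injective (ℤP.i-j≡0⇒i≡j (+ a) (+ b) a-b≡0)
  where
  a = x %ℕ d
  b = y %ℕ d
  a-b≡[x-y]-[x/d-y/d]*d : + a - + b ≡ (x - y) - (x /ℕ d - y /ℕ d) ℤ.* + d
  a-b≡[x-y]-[x/d-y/d]*d = begin
      + a - + b
    ≡⟨ solve 5 (λ a b p q d → a :- b := ((a :+ p :* d) :- (b :+ q :* d)) :- (p :- q) :* d)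
             refl (+ a) (+ b) (x /ℕ d) (y /ℕ d) (+ d) ⟩
      ((+ a ℤ.+ x /ℕ d ℤ.* + d) - (+ b ℤ.+ y /ℕ d ℤ.* + d)) - (x /ℕ d - y /ℕ d) ℤ.* + d
    ≡⟨ cong₂ (λ u v → (u - v) - (x /ℕ d - y /ℕ d) ℤ.* + d) (a≡a%ℕn+[a/ℕn]*n x d) (a≡a%ℕn+[a/ℕn]*n y d) ⟨
      (x - y) - (x /ℕ d - y /ℕ d) ℤ.* + d
    ∎
    where open ≡-Reasoning
  d∣a⊖b : + d ℤ∣.∣ a ⊖ b
  d∣a⊖b = subst (+ d ℤ∣.∣_) (trans (sym a-b≡[x-y]-[x/d-y/d]*d) (ℤP.m-n≡m⊖n a b))
                (∣m∣n⇒∣m-n d∣x-y (∣n⇒∣m*n (x /ℕ d - y /ℕ d) (∣-refl {+ d})))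
  a-b≡0 : + a - + b ≡ + 0
  a-b≡0 = trans (ℤP.m-n≡m⊖n a b)
                (ℤP.∣i∣≡0⇒i≡0 (n∣m<n⇒m≡0 (∣⇒∣ᵤ d∣a⊖b) (∣m⊖n∣<d (n%ℕd<d x d) (n%ℕd<d y d))))

-- φ is the reduction ℤ[ω] → ℤ[ω]/(1 - ω) ≅ 𝔽₃, which sends ω to 1.
φ : ℤω → ℤ
φ (a , b) = a ℤ.+ b

φ-mulω : ∀ z → φ (mulω z) ≡ φ z mod 3
φ-mulω (a , b) = mod-by (ℤ∣.divides (- b) (solve 2 (λ a b → (:- b :+ (a :- b)) :- (a :+ b) := :- b :* con (+ 3)) refl a b))

φ-mulω⁻¹ : ∀ z → φ (mulω⁻¹ z) ≡ φ z mod 3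
φ-mulω⁻¹ z = mod-trans (φ-mulω (mulω z)) (φ-mulω z)

φ-iter-mulω⁻¹ : ∀ n z → φ (iter n mulω⁻¹ z) ≡ φ z mod 3
φ-iter-mulω⁻¹ zero    z = mod-refl
φ-iter-mulω⁻¹ (suc n) z = mod-trans (φ-mulω⁻¹ (iter n mulω⁻¹ z)) (φ-iter-mulω⁻¹ n z)

φ-evalP : ∀ p → φ (evalP p) ≡ evalOne p mod 3
φ-evalP []      = mod-refl
φ-evalP (a ∷ p) = mod-trans (φ-horner (evalP p)) (mod-+ˡ a (φ-evalP p))
  where
  φ-horner : ∀ z → φ ((a , + 0) +ω mulω z) ≡ a ℤ.+ φ z mod 3
  φ-horner (x , y) = mod-by (ℤ∣.divides (- y)
    (solve 3 (λ a x y → ((a :+ :- y) :+ (con (+ 0) :+ (x :- y))) :- (a :+ (x :+ y)) := :- y :* con (+ 3)) refl a x y))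

φ-evalL : ∀ n p → φ (evalL (n , p)) ≡ evalOne p mod 3
φ-evalL n p = mod-trans (φ-iter-mulω⁻¹ n (evalP p)) (φ-evalP p)

CubeRootClass : ℕ → ℤω → Set
CubeRootClass 0 v                   = v ≡ zeroω
CubeRootClass 1 v                   = InCubeRoots v
CubeRootClass 2 v                   = InNegCubeRoots v
CubeRootClass (suc (suc (suc _))) v = ⊥

CubeRootClass-cases : ∀ {n v} → CubeRootClass n v →
  (n ≡ 0 → v ≡ zeroω) × (n ≡ 1 → InCubeRoots v) × (n ≡ 2 → InNegCubeRoots v)
CubeRootClass-cases {0} v≡0   = (λ _ → v≡0) , (λ ()) , (λ ())
CubeRootClass-cases {1} v∈μ₃  = (λ ()) , (λ _ → v∈μ₃) , (λ ())
CubeRootClass-cases {2} v∈-μ₃ = (λ ()) , (λ ()) , (λ _ → v∈-μ₃)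

CubeRootClass-φ : ∀ {v} → v ∈ zeroω ∷ units → CubeRootClass (φ v %ℕ 3) v
CubeRootClass-φ (here refl)                                             = refl
CubeRootClass-φ (there (here refl))                                     = inj₁ refl
CubeRootClass-φ (there (there (here refl)))                             = inj₂ (inj₁ refl)
CubeRootClass-φ (there (there (there (here refl))))                     = inj₂ (inj₂ refl)
CubeRootClass-φ (there (there (there (there (here refl)))))             = inj₁ refl
CubeRootClass-φ (there (there (there (there (there (here refl))))))     = inj₂ (inj₁ refl)
CubeRootClass-φ (there (there (there (there (there (there (here refl))))))) = inj₂ (inj₂ refl)

CubeRootClass-residue : ∀ {v t} → v ∈ zeroω ∷ units → φ v ≡ t mod 3 → CubeRootClass (t %ℕ 3) v
CubeRootClass-residue {v} v∈ φv≡t = subst (λ n → CubeRootClass n v) (%ℕ-cong 3 φv≡t) (CubeRootClass-φ v∈)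

-- Division by 1 + q + q²

coeff-+P : ∀ p p' n → coeff (p +P p') n ≡ coeff p n ℤ.+ coeff p' n
coeff-+P []      p'       n       = sym (ℤP.+-identityˡ (coeff p' n))
coeff-+P (a ∷ p) []       n       = sym (ℤP.+-identityʳ (coeff (a ∷ p) n))
coeff-+P (a ∷ p) (b ∷ p') zero    = refl
coeff-+P (a ∷ p) (b ∷ p') (suc n) = coeff-+P p p' n

coeff-·P : ∀ a p n → coeff (a ·P p) n ≡ a ℤ.* coeff p n
coeff-·P a []      n       = sym (ℤP.*-zeroʳ a)
coeff-·P a (b ∷ p) zero    = refl
coeff-·P a (b ∷ p) (suc n) = coeff-·P a p n

coeff-qInt-*P : ∀ c e n → coeff (qInt (suc c) *P e) n ≡ coeff e n ℤ.+ coeff (shiftP (qInt c *P e)) n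
coeff-qInt-*P c e n = trans (coeff-+P (+ 1 ·P e) (shiftP (qInt c *P e)) n)
                            (cong (ℤ._+ coeff (shiftP (qInt c *P e)) n) (trans (coeff-·P (+ 1) e n) (ℤP.*-identityˡ _)))

[3]-coeff : Poly → ℕ → ℤ
[3]-coeff e 0             = coeff e 0
[3]-coeff e 1             = coeff e 1 ℤ.+ coeff e 0
[3]-coeff e (suc (suc n)) = coeff e (suc (suc n)) ℤ.+ (coeff e (suc n) ℤ.+ coeff e n)

coeff-qInt3-*P : ∀ e n → coeff (qInt 3 *P e) n ≡ [3]-coeff e n
coeff-qInt3-*P e 0             = trans (coeff-qInt-*P 2 e 0) (ℤP.+-identityʳ _)
coeff-qInt3-*P e 1             = trans (coeff-qInt-*P 2 e 1)
  (cong (λ w → coeff e 1 ℤ.+ w) (trans (coeff-qInt-*P 1 e 0) (ℤP.+-identityʳ _)))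
coeff-qInt3-*P e (suc (suc n)) = begin
    coeff (qInt 3 *P e) (suc (suc n))
  ≡⟨ coeff-qInt-*P 2 e (suc (suc n)) ⟩
    coeff e (suc (suc n)) ℤ.+ coeff (qInt 2 *P e) (suc n)
  ≡⟨ cong (λ w → coeff e (suc (suc n)) ℤ.+ w) (coeff-qInt-*P 1 e (suc n)) ⟩
    coeff e (suc (suc n)) ℤ.+ (coeff e (suc n) ℤ.+ coeff (qInt 1 *P e) n)
  ≡⟨ cong (λ w → coeff e (suc (suc n)) ℤ.+ (coeff e (suc n) ℤ.+ w)) (trans (coeff-qInt-*P 0 e n) (coeff-+0 n)) ⟩
    coeff e (suc (suc n)) ℤ.+ (coeff e (suc n) ℤ.+ coeff e n)
  ∎
  where
  open ≡-Reasoning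
  coeff-+0 : ∀ n → coeff e n ℤ.+ coeff (+ 0 ∷ []) n ≡ coeff e n
  coeff-+0 zero    = ℤP.+-identityʳ (coeff e 0)
  coeff-+0 (suc n) = ℤP.+-identityʳ (coeff e (suc n))

-- As ω² = -1 - ω, the remainder of p modulo 1 + q + q² is evalP p = (x , y), read as x + y q.
quot[3] : Poly → Poly
quot[3] []      = []
quot[3] (a ∷ p) = proj₂ (evalP p) ∷ quot[3] p

remainder : ℤω → Poly
remainder (x , y) = x ∷ y ∷ []

division-by-[3] : ∀ p n → coeff p n ≡ [3]-coeff (quot[3] p) n ℤ.+ coeff (remainder (evalP p)) n
division-by-[3] []      0                   = refl
division-by-[3] []      1                   = refl
division-by-[3] []      (suc (suc n))       = refl
division-by-[3] (a ∷ p) n with evalP p | division-by-[3] p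
... | (x , y) | p≡[3]Q+x+yq = shifted n
  where
  Q = quot[3] p
  shifted : ∀ n → coeff (a ∷ p) n ≡ [3]-coeff (y ∷ Q) n ℤ.+ coeff (remainder ((a , + 0) +ω mulω (x , y))) n
  shifted 0                   = solve 2 (λ a y → a := y :+ (a :+ :- y)) refl a y
  shifted 1                   = trans (p≡[3]Q+x+yq 0)
    (solve 3 (λ Q₀ x y → Q₀ :+ x := (Q₀ :+ y) :+ (con (+ 0) :+ (x :- y))) refl (coeff Q 0) x y)
  shifted 2                   = trans (p≡[3]Q+x+yq 1) (solve 3 (λ Q₁ Q₀ y → (Q₁ :+ Q₀) :+ y := (Q₁ :+ (Q₀ :+ y)) :+ con (+ 0)) refl (coeff Q 1) (coeff Q 0) y)
  shifted (suc (suc (suc n))) = trans (p≡[3]Q+x+yq (suc (suc n)))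
    (trans (ℤP.+-identityʳ ([3]-coeff Q (suc (suc n)))) (sym (ℤP.+-identityʳ ([3]-coeff Q (suc (suc n))))))

evalP≡0⇒[3]∣P : ∀ p → evalP p ≡ zeroω → qInt 3 ∣P p
evalP≡0⇒[3]∣P p p[ω]≡0 = quot[3] p , λ n → begin
    coeff p n                                                        ≡⟨ division-by-[3] p n ⟩
    [3]-coeff (quot[3] p) n ℤ.+ coeff (remainder (evalP p)) n        ≡⟨ cong (λ z → [3]-coeff (quot[3] p) n ℤ.+ coeff (remainder z) n) p[ω]≡0 ⟩
    [3]-coeff (quot[3] p) n ℤ.+ coeff (remainder zeroω) n            ≡⟨ trans (cong (λ w → [3]-coeff (quot[3] p) n ℤ.+ w) (coeff-zero n)) (ℤP.+-identityʳ _) ⟩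
    [3]-coeff (quot[3] p) n                                          ≡⟨ coeff-qInt3-*P (quot[3] p) n ⟨
    coeff (qInt 3 *P quot[3] p) n                                    ∎
  where
  open ≡-Reasoning
  coeff-zero : ∀ n → coeff (remainder zeroω) n ≡ + 0
  coeff-zero 0             = refl
  coeff-zero 1             = refl
  coeff-zero (suc (suc n)) = refl

RS-at-ω : ∀ r s → 1 ≤ s → (evalL (proj₁ (RS r s)) , evalP (proj₂ (RS r s))) ∈ orbit
RS-at-ω r s 1≤s = RS-Induction.RS-induction (λ _ (L , S) → (evalL L , evalP S) ∈ orbit) 1≤s
  (λ n s<n → matProd-∈-orbit (negCF (suc s) n s) (negCF-positive (suc s) n s (ℕP.≤-trans 1≤s (ℕP.<⇒≤ s<n))))
  (λ r L S x∈orbit → subst (λ z → (z , evalP S) ∈ orbit) (sym (evalL-stepR L S)) (shiftω-closed x∈orbit))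
  r

RS-at-1 : ∀ r s → 1 ≤ s → (r , + s) IsMultipleOf (evalOne (proj₂ (proj₁ (RS r s))) , evalOne (proj₂ (RS r s)))
RS-at-1 r s 1≤s = RS-Induction.RS-induction (λ r (L , S) → (r , + s) IsMultipleOf (evalOne (proj₂ L) , evalOne S)) 1≤s
  (λ n s<n → negCF-at-1 (suc s) n s 1≤s (ℕP.n≤1+n s))
  (λ r L S multiple → subst (λ x → (r , + s) IsMultipleOf (x , evalOne S)) (sym (evalOne-stepR L S)) (IsMultipleOf-shift multiple))
  r

IsMultipleOf-coprime : ∀ {r s a b} → Coprime ℤ.∣ r ∣ s → (r , + s) IsMultipleOf (a , b) → a ≡ r × b ≡ + s
IsMultipleOf-coprime coprime (k , r≡ka , s≡kb) = k≡1⇒ r≡ka , k≡1⇒ s≡kb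
  where
  k∣ : ∀ {x y} → x ≡ + k ℤ.* y → k ∣ ℤ.∣ x ∣
  k∣ {y = y} x≡ky = divides ℤ.∣ y ∣ (trans (cong ℤ.∣_∣ x≡ky) (trans (ℤP.abs-* (+ k) y) (ℕP.*-comm k _)))
  k≡1 : k ≡ 1
  k≡1 = coprime (k∣ r≡ka , k∣ s≡kb)
  k≡1⇒ : ∀ {x y} → x ≡ + k ℤ.* y → y ≡ x
  k≡1⇒ {y = y} x≡ky = sym (trans x≡ky (trans (cong (λ n → + n ℤ.* y) k≡1) (ℤP.*-identityˡ y)))

corollary7p2 : (α : ℚ) →
    ((3 ∣ ↧ₙ α → qInt 3 ∣P proj₂ (RS (↥ α) (↧ₙ α)))
     × (↧ₙ α % 3 ≡ 0 → evalP (proj₂ (RS (↥ α) (↧ₙ α))) ≡ zeroω)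
     × (↧ₙ α % 3 ≡ 1 → InCubeRoots (evalP (proj₂ (RS (↥ α) (↧ₙ α)))))
     × (↧ₙ α % 3 ≡ 2 → InNegCubeRoots (evalP (proj₂ (RS (↥ α) (↧ₙ α))))))
    × ((↥ α %ℕ 3 ≡ 0 → evalL (proj₁ (RS (↥ α) (↧ₙ α))) ≡ zeroω)
     × (↥ α %ℕ 3 ≡ 1 → InCubeRoots (evalL (proj₁ (RS (↥ α) (↧ₙ α)))))
     × (↥ α %ℕ 3 ≡ 2 → InNegCubeRoots (evalL (proj₁ (RS (↥ α) (↧ₙ α))))))
corollary7p2 (mkℚ r d coprime) = (S-divisible , CubeRootClass-cases S-class) , CubeRootClass-cases R-class
  where
  s : ℕ
  s = suc d
  L : Laurent
  L = proj₁ (RS r s)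
  S : Poly
  S = proj₂ (RS r s)
  values-at-1 : evalOne (proj₂ L) ≡ r × evalOne S ≡ + s
  values-at-1 = IsMultipleOf-coprime (recompute coprime) (RS-at-1 r s (s≤s z≤n))
  values-at-ω : (evalL L ∈ zeroω ∷ units) × (evalP S ∈ zeroω ∷ units)
  values-at-ω = orbit-values (RS-at-ω r s (s≤s z≤n))
  S-class : CubeRootClass (s % 3) (evalP S)
  S-class = CubeRootClass-residue (proj₂ values-at-ω)
              (subst (λ t → φ (evalP S) ≡ t mod 3) (proj₂ values-at-1) (φ-evalP S))
  R-class : CubeRootClass (r %ℕ 3) (evalL L)
  R-class = CubeRootClass-residue (proj₁ values-at-ω)
              (subst (λ t → φ (evalL L) ≡ t mod 3) (proj₁ values-at-1) (φ-evalL (proj₁ L) (proj₂ L)))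
  S-divisible : 3 ∣ s → qInt 3 ∣P S
  S-divisible 3∣s = evalP≡0⇒[3]∣P S (proj₁ (CubeRootClass-cases S-class) (n∣m⇒m%n≡0 s 3 3∣s))
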